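{- Let $c\ge 1$, let $T$ be a rooted forest, and let $\mathcal P$ be a collection of $k\ge 1$ descending paths in $T$ (repetitions allowed) covering all edges of $T$. If $|E(T)|\ge 4ck(1+\log_2 k)$, then there exists a $c$-sparse path with respect to $\mathcal P$.
   Context: In a rooted forest, a descending path is a path starting at a node and ending at one of its descendants. Given a collection $\mathcal P=\{P_1,\dots,P_k\}$ of descending paths covering all edges, and a constant $c\ge 1$, a descending path $Q$ is $c$-sparse if $Q$ is a subpath of some $P_i$, has at least one edge, and the number of paths of $\mathcal P$ sharing at least one edge with $Q$ is at most $|E(Q)|/c$.
   Formalization: The constant $c$ takes only rational values with $c\ge 1$. -}

module Defs where

open import Data.Nat using (ℕ; zero; suc; _+_; _*_; _∸_; _^_; _≤_; _<_)
open import Data.Fin using (Fin; toℕ)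
open import Data.Fin.Properties using (any?)
open import Data.Maybe using (Maybe; just; nothing; _>>=_; is-just)
open import Data.Maybe.Properties using (≡-dec)
open import Data.Bool using (Bool; true)
open import Data.List using (List; length; filter; filterᵇ; allFin)
open import Data.Product using (Σ; _×_; _,_)
open import Relation.Binary.PropositionalEquality using (_≡_; _≢_)
open import Relation.Nullary using (Dec)

-- A rooted forest on vertex set Fin n, given by its parent map:
-- parent v = nothing  iff  v is a root.  The edges of the forest are the
-- pairs {v , parent v} with parent v = just _, so an edge is identified
-- with its lower (child) endpoint v.
Parent : ℕ → Set
Parent n = Fin n → Maybe (Fin n)

anc : ∀ {n} → Parent n → ℕ → Fin n → Maybe (Fin n)
anc par zero    v = just v
anc par (suc j) v = anc par j v >>= par

IsRootedForest : ∀ {n} → Parent n → Set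
IsRootedForest {n} par = ∀ v → anc par n v ≡ nothing

numEdges : ∀ {n} → Parent n → ℕ
numEdges {n} par = length (filterᵇ (λ v → is-just (par v)) (allFin n))

-- A descending path, described by its lowest vertex and its number of edges.
-- Its vertices are anc 0 bottom (= bottom), anc 1 bottom, ..., anc len bottom,
-- its edges are (child endpoints) anc j bottom for j < len.
record DPath (n : ℕ) : Set where
  constructor dpath
  field
    bottom : Fin n
    len    : ℕ
open DPath public

ValidPath : ∀ {n} → Parent n → DPath n → Set
ValidPath par P = anc par (len P) (bottom P) ≢ nothing

EdgeOn : ∀ {n} → Parent n → Fin n → DPath n → Set
EdgeOn par v P = Σ ℕ λ j → (j < len P) × (anc par j (bottom P) ≡ just v)

SubPath : ∀ {n} → Parent n → DPath n → DPath n → Set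
SubPath par Q P =
  Σ ℕ λ j → (anc par j (bottom P) ≡ just (bottom Q)) × (j + len Q ≤ len P)

ShareEdge : ∀ {n} → Parent n → DPath n → DPath n → Set
ShareEdge par P Q =
  Σ (Fin (len P)) λ j → Σ (Fin (len Q)) λ j' →
    anc par (toℕ j) (bottom P) ≡ anc par (toℕ j') (bottom Q)

shareEdge? : ∀ {n} (par : Parent n) (P Q : DPath n) → Dec (ShareEdge par P Q)
shareEdge? par P Q =
  any? λ j → any? λ j' → ≡-dec Data.Fin._≟_ (anc par (toℕ j) (bottom P)) (anc par (toℕ j') (bottom Q))
  where import Data.Fin

numSharing : ∀ {n k} → Parent n → (Fin k → DPath n) → DPath n → ℕ
numSharing {k = k} par Ps Q =
  length (filter (λ i → shareEdge? par (Ps i) Q) (allFin k))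

Covers : ∀ {n k} → Parent n → (Fin k → DPath n) → Set
Covers {n} par Ps = ∀ (v : Fin n) → par v ≢ nothing → Σ _ λ i → EdgeOn par v (Ps i)

-- Q is c-sparse with respect to Ps, where c = p / q (q ≥ 1):
-- Q is a subpath of some P_i, has at least one edge, and
-- (#paths sharing an edge with Q) ≤ |E(Q)| / c, i.e.  # * p ≤ |E(Q)| * q.
Sparse : ∀ {n k} → Parent n → (Fin k → DPath n) → (p q : ℕ) → DPath n → Set
Sparse par Ps p q Q =
  ValidPath par Q × (Σ _ λ i → SubPath par Q (Ps i)) × (1 ≤ len Q)
  × (numSharing par Ps Q * p ≤ len Q * q)

-- |E(T)| ≥ 4 c k (1 + log₂ k) with c = p / q, k ≥ 1, E = |E(T)|, rewritten
-- exactly in ℕ:  4pk ≤ E q  and  k ^ (4pk) ≤ 2 ^ (E q ∸ 4pk).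
BigEnough : (p q k E : ℕ) → Set
BigEnough p q k E = (4 * p * k ≤ E * q) × (k ^ (4 * p * k) ≤ 2 ^ (E * q ∸ 4 * p * k))

-- Heavy-path decomposition.  Let the weight of a vertex v be the number of paths whose
-- lowest edge lies below v, and call the edge from x to its parent u heavy if
-- weight u < 2 · weight x; a vertex has at most one heavy child.  Cut the edges into
-- chains, each inside a single path of 𝒫 (its owner): x extends the chain through its
-- parent u when the edge from x to u is heavy and x lies on the owner of that chain;
-- otherwise x starts a new chain, owned by a path through x that follows the heavy run
-- below x furthest.  A path sharing an edge with a chain either contains the top edge of
-- the chain or has its own top edge on it, and the second happens for at most one chain
-- per path.  Along a path P, the edge above every chain top except the highest one is
-- light: were it heavy, P would follow the heavy run below the next chain top further
-- than the owner of that chain.  Weights at least double across light edges, so P meets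
-- at most 1 + log₂ k chain tops.  Hence the chains, whose lengths add up to |E(T)|,
-- share at most k (2 + log₂ k) paths in total, and one of them must be c-sparse.

module Submission where

open import Defs

open import Data.Bool using (T; if_then_else_)
open import Data.Empty using (⊥; ⊥-elim)
open import Data.Fin using (Fin; zero; suc; toℕ; fromℕ<; fromℕ; inject₁)
open import Data.Fin.Properties using (toℕ<n; toℕ-inject₁; toℕ-fromℕ; toℕ-fromℕ<)
import Data.Fin.Properties as Fin
open import Data.List using (length; filter; tabulate; allFin)
open import Data.List.Extrema.Nat using (argmax; f[xs]≤f[argmax])
open import Data.List.Membership.Propositional.Properties using (∈-allFin)
import Data.List.Relation.Unary.All as All
open import Data.Maybe using (Maybe; just; nothing; _>>=_; maybe′; is-just)
open import Data.Maybe.Properties using (just-injective)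
import Data.Maybe.Properties as Maybe
open import Data.Maybe.Relation.Unary.Any using (Any; just)
import Data.Maybe.Relation.Unary.Any as Anyᴹ
open import Data.Nat
  using (ℕ; zero; suc; _+_; _*_; _∸_; _^_; _≤_; _<_; z≤n; s≤s; s≤s⁻¹; z<s; _≤?_; _<?_; pred; NonZero; >-nonZero; >-nonZero⁻¹)
open import Data.Nat.Properties
open import Data.Nat.Tactic.RingSolver using (solve-∀)
open import Data.Product using (Σ; _×_; _,_; proj₁; proj₂; ∃)
open import Data.Sum using (_⊎_; inj₁; inj₂)
open import Function using (_∘_; case_of_; id)
open import Relation.Binary.Definitions using (tri<; tri≈; tri>)
open import Relation.Binary.PropositionalEquality
open import Relation.Nullary using (Dec; yes; no; ¬_; does)
open import Relation.Nullary.Decidable using (_×-dec_; ¬?; decidable-stable; T?)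
open import Algebra.Properties.CommutativeSemigroup +-commutativeSemigroup using () renaming (interchange to +-interchange)
open import Algebra.Properties.Semiring.Sum +-*-semiring
  using (sum; sum-syntax; ∑-comm; ∑-distrib-+; sum-init-last; sum-cong-≗; *-distribˡ-sum; *-distribʳ-sum)

-- Counting

𝟙 : ∀ {a} {A : Set a} → Dec A → ℕ
𝟙 (yes _) = 1
𝟙 (no _)  = 0

𝟙≤1 : ∀ {a} {A : Set a} (a? : Dec A) → 𝟙 a? ≤ 1
𝟙≤1 (yes _) = ≤-refl
𝟙≤1 (no _)  = z≤n

𝟙-yes : ∀ {a} {A : Set a} (a? : Dec A) → A → 𝟙 a? ≡ 1
𝟙-yes (yes _) _  = refl
𝟙-yes (no ¬a) a  = ⊥-elim (¬a a)

𝟙-no : ∀ {a} {A : Set a} (a? : Dec A) → ¬ A → 𝟙 a? ≡ 0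
𝟙-no (yes a) ¬a = ⊥-elim (¬a a)
𝟙-no (no _)  _  = refl

𝟙-mono : ∀ {a b} {A : Set a} {B : Set b} (a? : Dec A) (b? : Dec B) → (A → B) → 𝟙 a? ≤ 𝟙 b?
𝟙-mono (yes a) b? f = ≤-reflexive (sym (𝟙-yes b? (f a)))
𝟙-mono (no _)  _  _ = z≤n

𝟙-×-dec : ∀ {a b} {A : Set a} {B : Set b} (a? : Dec A) (b? : Dec B) → 𝟙 (a? ×-dec b?) ≡ 𝟙 a? * 𝟙 b?
𝟙-×-dec (yes _) (yes _) = refl
𝟙-×-dec (yes _) (no _)  = refl
𝟙-×-dec (no _)  _       = refl

𝟙-⊎ : ∀ {a b c} {A : Set a} {B : Set b} {C : Set c} (a? : Dec A) (b? : Dec B) (c? : Dec C) →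
      (A → B ⊎ C) → 𝟙 a? ≤ 𝟙 b? + 𝟙 c?
𝟙-⊎ (no _)  _  _  _ = z≤n
𝟙-⊎ (yes a) b? c? f with f a
... | inj₁ b = ≤-trans (≤-reflexive (sym (𝟙-yes b? b))) (m≤m+n _ _)
... | inj₂ c = ≤-trans (≤-reflexive (sym (𝟙-yes c? c))) (m≤n+m _ _)

sum-mono-≤ : ∀ {m} {f g : Fin m → ℕ} → (∀ i → f i ≤ g i) → sum f ≤ sum g
sum-mono-≤ {zero}  _   = z≤n
sum-mono-≤ {suc m} f≤g = +-mono-≤ (f≤g zero) (sum-mono-≤ (f≤g ∘ suc))

sum-mono-< : ∀ {m} {f g : Fin m → ℕ} → (∀ i → f i ≤ g i) → ∀ i → f i < g i → sum f < sum g
sum-mono-< f≤g zero    fi<gi = +-mono-<-≤ fi<gi (sum-mono-≤ (f≤g ∘ suc))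
sum-mono-< f≤g (suc i) fi<gi = +-mono-≤-< (f≤g zero) (sum-mono-< (f≤g ∘ suc) i fi<gi)

≤-sum : ∀ {m} (f : Fin m → ℕ) i → f i ≤ sum f
≤-sum f zero    = m≤m+n (f zero) _
≤-sum f (suc i) = ≤-trans (≤-sum (f ∘ suc) i) (m≤n+m _ (f zero))

sum-const : ∀ m c → sum {m} (λ _ → c) ≡ m * c
sum-const zero    c = refl
sum-const (suc m) c = cong (c +_) (sum-const m c)

sum-≤-* : ∀ {m} {f : Fin m → ℕ} c → (∀ i → f i ≤ c) → sum f ≤ m * c
sum-≤-* {m} c f≤c = ≤-trans (sum-mono-≤ f≤c) (≤-reflexive (sum-const m c))

count : ∀ {m} {P : Fin m → Set} → (∀ i → Dec (P i)) → ℕ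
count {m} P? = ∑[ i < m ] 𝟙 (P? i)

length-filter-tabulate : ∀ {m} {A : Set} {P : A → Set} (P? : ∀ x → Dec (P x)) (f : Fin m → A) →
                         length (filter P? (tabulate f)) ≡ count (P? ∘ f)
length-filter-tabulate {zero}  P? f = refl
length-filter-tabulate {suc m} P? f with P? (f zero)
... | yes _ = cong suc (length-filter-tabulate P? (f ∘ suc))
... | no _  = length-filter-tabulate P? (f ∘ suc)

count-≤1 : ∀ {m} {P : Fin m → Set} (P? : ∀ i → Dec (P i)) →
           (∀ i j → P i → P j → i ≡ j) → count P? ≤ 1
count-≤1 {zero}  P? unique = z≤n
count-≤1 {suc m} P? unique with P? zero
... | no _   = count-≤1 (P? ∘ suc) (λ i j pi pj → Fin.suc-injective (unique (suc i) (suc j) pi pj))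
... | yes p0 = s≤s (≤-trans (sum-≤-* 0 none) (≤-reflexive (*-zeroʳ m)))
  where
  none : ∀ i → 𝟙 (P? (suc i)) ≤ 0
  none i = ≤-reflexive (𝟙-no (P? (suc i)) λ pi → 0≢1+n (cong toℕ (unique zero (suc i) p0 pi)))

count-none : ∀ {m} {P : Fin m → Set} (P? : ∀ i → Dec (P i)) → (∀ i → ¬ P i) → count P? ≡ 0
count-none {m} P? ¬P = n≤0⇒n≡0 (≤-trans (sum-≤-* 0 λ i → ≤-reflexive (𝟙-no (P? i) (¬P i))) (≤-reflexive (*-zeroʳ m)))

count-≤-∑count : ∀ {l m} {A : Fin m → Set} {R : Fin l → Fin m → Set}
                 (A? : ∀ x → Dec (A x)) (R? : ∀ j x → Dec (R j x)) →
                 (∀ x → A x → ∃ λ j → R j x) → count A? ≤ ∑[ j < l ] count (R? j)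
count-≤-∑count {l} {m} A? R? hit = begin
  count A?                         ≤⟨ sum-mono-≤ A≤R ⟩
  ∑[ x < m ] ∑[ j < l ] 𝟙 (R? j x) ≡⟨ ∑-comm (λ x j → 𝟙 (R? j x)) ⟩
  ∑[ j < l ] count (R? j)          ∎
  where
  open ≤-Reasoning
  A≤R : ∀ x → 𝟙 (A? x) ≤ ∑[ j < l ] 𝟙 (R? j x)
  A≤R x with A? x
  ... | no _  = z≤n
  ... | yes a = let (j , r) = hit x a in
                ≤-trans (≤-reflexive (sym (𝟙-yes (R? j x) r))) (≤-sum (λ j → 𝟙 (R? j x)) j)

count-≤-via : ∀ {l m} {A : Fin m → Set} {C : Fin l → Set} {R : Fin l → Fin m → Set}
              (A? : ∀ x → Dec (A x)) (C? : ∀ j → Dec (C j)) (R? : ∀ j x → Dec (R j x)) →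
              (∀ x → A x → ∃ λ j → R j x) → (∀ j x y → R j x → R j y → x ≡ y) →
              (∀ j x → R j x → C j) → count A? ≤ count C?
count-≤-via A? C? R? hit unique into = ≤-trans (count-≤-∑count A? R? hit) (sum-mono-≤ R≤C)
  where
  R≤C : ∀ j → count (R? j) ≤ 𝟙 (C? j)
  R≤C j with C? j
  ... | yes _ = count-≤1 (R? j) (unique j)
  ... | no ¬c = ≤-reflexive (count-none (R? j) λ x r → ¬c (into j x r))

sum< : ℕ → (ℕ → ℕ) → ℕ
sum< L g = ∑[ j < L ] g (toℕ j)

sum<-suc : ∀ L g → sum< (suc L) g ≡ sum< L g + g L
sum<-suc L g = begin
  sum< (suc L) g
    ≡⟨ sum-init-last (g ∘ toℕ) ⟩
  ∑[ j < L ] g (toℕ (inject₁ j)) + g (toℕ (fromℕ L))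
    ≡⟨ cong₂ _+_ (sum-cong-≗ {L} (cong g ∘ toℕ-inject₁)) (cong g (toℕ-fromℕ L)) ⟩
  sum< L g + g L
    ∎
  where open ≡-Reasoning

count< : ∀ {P : ℕ → Set} → ℕ → (∀ j → Dec (P j)) → ℕ
count< L P? = sum< L (𝟙 ∘ P?)

count<-≤-1+ : ∀ {T Lt : ℕ → Set} (T? : ∀ j → Dec (T j)) (Lt? : ∀ j → Dec (Lt j)) L →
              (∀ {j j'} → j < j' → j' < L → T j → T j' → Lt j) → count< L T? ≤ 1 + count< L Lt?
count<-≤-1+ {T} {Lt} T? Lt? L all-but-last = prefix L ≤-refl
  where
  prefix : ∀ m → m ≤ L → count< m T? ≤ 1 + count< m Lt?
  prefix zero    _   = z≤n
  prefix (suc m) m<L = subst₂ _≤_ (sym (sum<-suc m (𝟙 ∘ T?))) (cong suc (sym (sum<-suc m (𝟙 ∘ Lt?)))) (last (T? m))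
    where
    open ≤-Reasoning
    last : (d : Dec (T m)) → count< m T? + 𝟙 d ≤ 1 + (count< m Lt? + 𝟙 (Lt? m))
    last (no _) = begin
      count< m T? + 0              ≡⟨ +-identityʳ _ ⟩
      count< m T?                  ≤⟨ prefix m (<⇒≤ m<L) ⟩
      1 + count< m Lt?             ≤⟨ +-monoʳ-≤ 1 (m≤m+n _ _) ⟩
      1 + (count< m Lt? + 𝟙 (Lt? m)) ∎
    last (yes tm) = begin
      count< m T? + 1              ≡⟨ +-comm _ 1 ⟩
      1 + count< m T?              ≤⟨ +-monoʳ-≤ 1 (sum-mono-≤ earlier) ⟩
      1 + count< m Lt?             ≤⟨ +-monoʳ-≤ 1 (m≤m+n _ _) ⟩
      1 + (count< m Lt? + 𝟙 (Lt? m)) ∎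
      where
      earlier : ∀ j → 𝟙 (T? (toℕ j)) ≤ 𝟙 (Lt? (toℕ j))
      earlier j = 𝟙-mono (T? _) (Lt? _) λ tj → all-but-last (toℕ<n j) m<L tj tm

-- Arithmetic

exponent-≤ : ∀ {ℓ k M Y} → 2 ^ ℓ ≤ k → k ^ M ≤ 2 ^ Y → ℓ * M ≤ Y
exponent-≤ {ℓ} {k} {M} {Y} 2^ℓ≤k k^M≤2^Y = ≮⇒≥ λ Y<ℓM → <⇒≱ (^-monoʳ-< 2 (s≤s (s≤s z≤n)) Y<ℓM) (begin
  2 ^ (ℓ * M) ≡⟨ ^-*-assoc 2 ℓ M ⟨
  (2 ^ ℓ) ^ M ≤⟨ ^-monoˡ-≤ M 2^ℓ≤k ⟩
  k ^ M       ≤⟨ k^M≤2^Y ⟩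
  2 ^ Y       ∎)
  where open ≤-Reasoning

∑[2+ℓ]*p<X : ∀ {p k X} (ℓ : Fin k → ℕ) → 1 ≤ p → 1 ≤ k → 4 * p * k ≤ X →
            (∀ i → ℓ i * (4 * p * k) ≤ X ∸ 4 * p * k) → ∑[ i < k ] (2 + ℓ i) * p < X
∑[2+ℓ]*p<X {p} {k} {X} ℓ 1≤p 1≤k M≤X ℓM≤Y = *-cancelˡ-< 4 _ _ (begin-strict
  4 * (∑[ i < k ] (2 + ℓ i) * p) ≡⟨ cong (λ t → 4 * (t * p)) sum-2+ℓ ⟩
  4 * ((k * 2 + s) * p)          ≡⟨ expand p k s ⟩
  2 * M + 4 * p * s              ≤⟨ +-monoʳ-≤ (2 * M) 4ps≤Y ⟩
  2 * M + Y                      ≡⟨ regroup M Y ⟩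
  M + (Y + M)                    ≡⟨ cong (M +_) (m∸n+n≡m M≤X) ⟩
  M + X                          ≤⟨ +-monoˡ-≤ X M≤X ⟩
  X + X                          <⟨ +-monoʳ-< X (m<m+n X (≤-trans 0<M (≤-trans M≤X (m≤m+n X _)))) ⟩
  4 * X                          ∎)
  where
  open ≤-Reasoning
  M Y s : ℕ
  M = 4 * p * k
  Y = X ∸ M
  s = ∑[ i < k ] ℓ i
  sum-2+ℓ : ∑[ i < k ] (2 + ℓ i) ≡ k * 2 + s
  sum-2+ℓ = trans (∑-distrib-+ (λ _ → 2) ℓ) (cong (_+ s) (sum-const k 2))
  0<M : 0 < M
  0<M = *-mono-≤ (*-mono-≤ {1} {4} (s≤s z≤n) 1≤p) 1≤k
  sM≤kY : s * M ≤ k * Y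
  sM≤kY = ≤-trans (≤-reflexive (*-distribʳ-sum M ℓ)) (sum-≤-* Y ℓM≤Y)
  4ps≤Y : 4 * p * s ≤ Y
  4ps≤Y = *-cancelˡ-≤ k ⦃ >-nonZero 1≤k ⦄ (≤-trans (≤-reflexive (swap p k s)) sM≤kY)
    where
    swap : ∀ p k s → k * (4 * p * s) ≡ s * (4 * p * k)
    swap = solve-∀
  expand : ∀ p k s → 4 * ((k * 2 + s) * p) ≡ 2 * (4 * p * k) + 4 * p * s
  expand = solve-∀
  regroup : ∀ M Y → 2 * M + Y ≡ M + (Y + M)
  regroup = solve-∀

-- Ancestors in a rooted forest

_≟ᴹ_ : ∀ {n} (a b : Maybe (Fin n)) → Dec (a ≡ b)
_≟ᴹ_ = Maybe.≡-dec Fin._≟_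

module ParentMap {n} (par : Parent n) where

  anc-+-just : ∀ i {j v x} → anc par j v ≡ just x → anc par (i + j) v ≡ anc par i x
  anc-+-just zero    eq = eq
  anc-+-just (suc i) eq = cong (_>>= par) (anc-+-just i eq)

  anc-+-nothing : ∀ i {j v} → anc par j v ≡ nothing → anc par (i + j) v ≡ nothing
  anc-+-nothing zero    eq = eq
  anc-+-nothing (suc i) eq = cong (_>>= par) (anc-+-nothing i eq)

  anc-∸-just : ∀ {i j v x} → i ≤ j → anc par i v ≡ just x → anc par j v ≡ anc par (j ∸ i) x
  anc-∸-just {i} {j} i≤j eq = trans (cong (λ m → anc par m _) (sym (m∸n+n≡m i≤j))) (anc-+-just (j ∸ i) eq)

  anc-suc-just : ∀ a {w c} → anc par a w ≡ just c → anc par (suc a) w ≡ par c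
  anc-suc-just a eq = cong (_>>= par) eq

  anc-suc-parent : ∀ f {v u} → par v ≡ just u → anc par (suc f) v ≡ anc par f u
  anc-suc-parent f {v} eq = trans (cong (λ m → anc par m v) (+-comm 1 f)) (anc-+-just f eq)

  IsEdge : Fin n → Set
  IsEdge u = ∃ λ w → par u ≡ just w

  isEdge? : ∀ u → Dec (IsEdge u)
  isEdge? u with par u
  ... | just w  = yes (w , refl)
  ... | nothing = no λ ()

  parent? : ∀ {P : Fin n → Set} → (∀ u → Dec (P u)) → ∀ x → Dec (∃ λ u → par x ≡ just u × P u)
  parent? P? x with par x
  ... | nothing = no λ ()
  ... | just u with P? u
  ...   | yes p = yes (u , refl , p)
  ...   | no ¬p = no λ { (_ , refl , p) → ¬p p }

  edgeOn? : ∀ v P → Dec (EdgeOn par v P)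
  edgeOn? v P = anyUpTo? (λ j → anc par j (bottom P) ≟ᴹ just v) (len P)

  edgeOn-position : ∀ {v P} → EdgeOn par v P → ∃ λ (j : Fin (len P)) → anc par (toℕ j) (bottom P) ≡ just v
  edgeOn-position {v} {P} (a , a<len , ev) =
    fromℕ< a<len , subst (λ a → anc par a (bottom P) ≡ just v) (sym (toℕ-fromℕ< a<len)) ev

  edges-on-path : ∀ P → count (λ v → edgeOn? v P) ≤ len P
  edges-on-path P = begin
    count (λ v → edgeOn? v P)    ≤⟨ count-≤-∑count _ at? (λ _ → edgeOn-position) ⟩
    ∑[ j < len P ] count (at? j) ≤⟨ sum-≤-* {len P} 1 (λ j → count-≤1 (at? j) λ _ _ ex ey → just-injective (trans (sym ex) ey)) ⟩
    len P * 1                    ≡⟨ *-identityʳ (len P) ⟩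
    len P                        ∎
    where
    open ≤-Reasoning
    at? : ∀ (j : Fin (len P)) v → Dec (anc par (toℕ j) (bottom P) ≡ just v)
    at? j v = anc par (toℕ j) (bottom P) ≟ᴹ just v

module Forest {n} (par : Parent n) (acyclic : IsRootedForest par) where

  open ParentMap par public

  anc-≥n : ∀ {a} v → n ≤ a → anc par a v ≡ nothing
  anc-≥n {a} v n≤a = trans (cong (λ m → anc par m v) (sym (m∸n+n≡m n≤a))) (anc-+-nothing (a ∸ n) (acyclic v))

  anc-<n : ∀ a {v x} → anc par a v ≡ just x → a < n
  anc-<n a {v} eq with a <? n
  ... | yes a<n = a<n
  ... | no a≮n  = case trans (sym eq) (anc-≥n v (≮⇒≥ a≮n)) of λ ()

  anc-defined : ∀ {i j v} → i ≤ j → anc par j v ≢ nothing → ∃ λ x → anc par i v ≡ just x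
  anc-defined {i} {j} {v} i≤j defined with anc par i v in eq
  ... | just x  = x , refl
  ... | nothing = ⊥-elim (defined (trans (cong (λ m → anc par m v) (sym (m∸n+n≡m i≤j))) (anc-+-nothing (j ∸ i) eq)))

  no-cycle : ∀ {d x} → 0 < d → anc par d x ≢ just x
  no-cycle {d} {x} 0<d cycle = case trans (sym (iterate n)) (anc-≥n x (m≤m*n n d {{>-nonZero 0<d}})) of λ ()
    where
    iterate : ∀ m → anc par (m * d) x ≡ just x
    iterate zero    = refl
    iterate (suc m) = trans (anc-+-just d (iterate m)) cycle

  anc-injective : ∀ {i j v x} → anc par i v ≡ just x → anc par j v ≡ just x → i ≡ j
  anc-injective {i} {j} ei ej with <-cmp i j
  ... | tri≈ _ i≡j _ = i≡j
  ... | tri< i<j _ _ = ⊥-elim (no-cycle (m<n⇒0<n∸m i<j) (trans (sym (anc-∸-just (<⇒≤ i<j) ei)) ej))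
  ... | tri> _ _ j<i = ⊥-elim (no-cycle (m<n⇒0<n∸m j<i) (trans (sym (anc-∸-just (<⇒≤ j<i) ej)) ei))

  -- The bound a < n holds anyway (anc-<n); it only makes Below decidable.
  Below : Fin n → Fin n → Set
  Below w v = ∃ λ a → a < n × anc par a w ≡ just v

  below? : ∀ w v → Dec (Below w v)
  below? w v = anyUpTo? (λ a → anc par a w ≟ᴹ just v) n

  below-parent : ∀ {w c u} → Below w c → par c ≡ just u → Below w u
  below-parent (a , _ , eq) pc = let up = trans (anc-suc-just a eq) pc in suc a , anc-<n (suc a) up , up

  below-siblings : ∀ {w c c' u} → Below w c → Below w c' → par c ≡ just u → par c' ≡ just u → c ≡ c'
  below-siblings (a , _ , ea) (a' , _ , ea') pc pc'
    with anc-injective {suc a} {suc a'} (trans (anc-suc-just a ea) pc) (trans (anc-suc-just a' ea') pc')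
  ... | refl = just-injective (trans (sym ea) ea')

  module _ {B : Set} (root : Fin n → B) (step : Fin n → Fin n → B → B) where

    foldUpFuel : ℕ → Fin n → B
    foldUpFuel zero    x = root x
    foldUpFuel (suc f) x = maybe′ (λ u → step x u (foldUpFuel f u)) (root x) (par x)

    foldUp : Fin n → B
    foldUp = foldUpFuel (suc n)

    foldUpFuel-irrelevant : ∀ f f' {x} → anc par f x ≡ nothing → anc par f' x ≡ nothing →
                            foldUpFuel f x ≡ foldUpFuel f' x
    foldUpFuel-irrelevant (suc f) (suc f') {x} ef ef' with par x in eq
    ... | nothing = refl
    ... | just u  = cong (step x u) (foldUpFuel-irrelevant f f'
                      (trans (sym (anc-suc-parent f eq)) ef) (trans (sym (anc-suc-parent f' eq)) ef'))

    foldUp-parent : ∀ {x u} → par x ≡ just u → foldUp x ≡ step x u (foldUp u)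
    foldUp-parent {u = u} eq rewrite eq =
      cong (step _ u) (foldUpFuel-irrelevant n (suc n) (acyclic u) (anc-+-nothing 1 {n} (acyclic u)))

    foldUp-root : ∀ {x} → par x ≡ nothing → foldUp x ≡ root x
    foldUp-root eq rewrite eq = refl

-- The heavy-path decomposition

module Decomposition {n} (par : Parent n) (acyclic : IsRootedForest par)
                     {k} ⦃ _ : NonZero k ⦄ (Ps : Fin k → DPath n) (covers : Covers par Ps) where

  open Forest par acyclic

  HasBottomBelow : Fin k → Fin n → Set
  HasBottomBelow i v = Below (bottom (Ps i)) v

  hasBottomBelow? : ∀ i v → Dec (HasBottomBelow i v)
  hasBottomBelow? i v = below? (bottom (Ps i)) v

  opaque
    weight : Fin n → ℕ
    weight v = count (λ i → hasBottomBelow? i v)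

    weight-parent : ∀ {x u} → par x ≡ just u → weight x ≤ weight u
    weight-parent pu = sum-mono-≤ λ i → 𝟙-mono (hasBottomBelow? i _) (hasBottomBelow? i _) λ below → below-parent below pu

    weight-siblings : ∀ {c c' u} → par c ≡ just u → par c' ≡ just u → c ≢ c' → weight c + weight c' ≤ weight u
    weight-siblings {c} {c'} {u} pc pc' c≢c' = begin
      weight c + weight c'                                        ≡⟨ ∑-distrib-+ (𝟙 ∘ (λ i → hasBottomBelow? i c)) _ ⟨
      ∑[ i < k ] (𝟙 (hasBottomBelow? i c) + 𝟙 (hasBottomBelow? i c')) ≤⟨ sum-mono-≤ disjoint ⟩
      weight u                                                    ∎
      where
      open ≤-Reasoning
      disjoint : ∀ i → 𝟙 (hasBottomBelow? i c) + 𝟙 (hasBottomBelow? i c') ≤ 𝟙 (hasBottomBelow? i u)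
      disjoint i with hasBottomBelow? i c | hasBottomBelow? i c'
      ... | yes b | yes b' = ⊥-elim (c≢c' (below-siblings b b' pc pc'))
      ... | yes b | no _   = ≤-reflexive (sym (𝟙-yes (hasBottomBelow? i u) (below-parent b pc)))
      ... | no _  | yes b' = ≤-reflexive (sym (𝟙-yes (hasBottomBelow? i u) (below-parent b' pc')))
      ... | no _  | no _   = z≤n

    weight-bottom : ∀ i → 1 ≤ weight (bottom (Ps i))
    weight-bottom i = ≤-trans (≤-reflexive (sym (𝟙-yes (hasBottomBelow? i b) (0 , 0<n , refl))))
                                (≤-sum (λ j → 𝟙 (hasBottomBelow? j b)) i)
      where
      b : Fin n
      b = bottom (Ps i)
      0<n : 0 < n
      0<n = ≤-trans z<s (toℕ<n b)

    weight-≤ : ∀ v → weight v ≤ k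
    weight-≤ v = ≤-trans (sum-≤-* 1 (λ i → 𝟙≤1 (hasBottomBelow? i v))) (≤-reflexive (*-identityʳ k))

  Heavy : Fin n → Fin n → Set
  Heavy x u = weight u < weight x + weight x

  heavy? : ∀ x u → Dec (Heavy x u)
  heavy? x u = weight u <? weight x + weight x

  heavy-unique : ∀ {c c' u} → par c ≡ just u → par c' ≡ just u → Heavy c u → Heavy c' u → c ≡ c'
  heavy-unique {c} {c'} {u} pc pc' h h' with c Fin.≟ c'
  ... | yes c≡c' = c≡c'
  ... | no c≢c'  = ⊥-elim (<⇒≱ (+-mono-< h h') (begin
    weight c + weight c + (weight c' + weight c') ≡⟨ +-interchange (weight c) _ _ _ ⟩
    weight c + weight c' + (weight c + weight c') ≤⟨ +-mono-≤ siblings siblings ⟩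
    weight u + weight u                           ∎))
    where
    open ≤-Reasoning
    siblings : weight c + weight c' ≤ weight u
    siblings = weight-siblings pc pc' c≢c'

  HeavyUp : Fin n → Set
  HeavyUp z = ∃ λ u → par z ≡ just u × Heavy z u

  heavyUp? : ∀ z → Dec (HeavyUp z)
  heavyUp? z = parent? (heavy? z) z

  -- As in Below, the bound d < n only makes HeavyRun decidable.
  HeavyRun : Fin n → Fin n → Set
  HeavyRun w t = ∃ λ d → d < n × anc par (suc d) w ≡ just t × (∀ {s} → s < suc d → Any HeavyUp (anc par s w))

  heavyRun? : ∀ w t → Dec (HeavyRun w t)
  heavyRun? w t = anyUpTo? (λ d → (anc par (suc d) w ≟ᴹ just t)
                                  ×-dec allUpTo? (λ s → Anyᴹ.dec heavyUp? (anc par s w)) (suc d)) n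

  opaque
    reach : Fin k → Fin n → ℕ
    reach r t = count (λ w → edgeOn? w (Ps r) ×-dec heavyRun? w t)

    reach-< : ∀ {r r' t} → (∀ {w} → EdgeOn par w (Ps r) → HeavyRun w t → EdgeOn par w (Ps r')) →
              ∀ {x} → ¬ EdgeOn par x (Ps r) → EdgeOn par x (Ps r') → HeavyRun x t → reach r t < reach r' t
    reach-< {r} {r'} {t} incl {x} ¬on on run = sum-mono-<
      (λ w → 𝟙-mono (edgeOn? w (Ps r) ×-dec heavyRun? w t) (edgeOn? w (Ps r') ×-dec heavyRun? w t) λ (o , h) → incl o h , h)
      x (subst₂ _<_ (sym (𝟙-no (edgeOn? x (Ps r) ×-dec heavyRun? x t) (¬on ∘ proj₁)))
                    (sym (𝟙-yes (edgeOn? x (Ps r') ×-dec heavyRun? x t) (on , run))) z<s)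

  score : Fin n → Fin k → ℕ
  score t r = if does (edgeOn? t (Ps r)) then suc (reach r t) else 0

  opaque
    best : Fin n → Fin k
    best t = argmax (score t) (fromℕ< (>-nonZero⁻¹ k)) (allFin k)

    score-≤-best : ∀ t i → score t i ≤ score t (best t)
    score-≤-best t i = All.lookup (f[xs]≤f[argmax] _ (allFin k)) (∈-allFin i)

  best-maximal : ∀ {t i} → EdgeOn par t (Ps i) → EdgeOn par t (Ps (best t)) × reach i t ≤ reach (best t) t
  best-maximal {t} {i} on = compare (edgeOn? t (Ps i)) (edgeOn? t (Ps (best t))) (score-≤-best t i)
    where
    compare : (d : Dec (EdgeOn par t (Ps i))) (d' : Dec (EdgeOn par t (Ps (best t)))) →
              (if does d then suc (reach i t) else 0) ≤ (if does d' then suc (reach (best t) t) else 0) →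
              EdgeOn par t (Ps (best t)) × reach i t ≤ reach (best t) t
    compare (yes _)  (yes on') ≤best = on' , s≤s⁻¹ ≤best
    compare (yes _)  (no _)    ()
    compare (no ¬on) _         _     = ⊥-elim (¬on on)

  Continues : Fin n → Fin n → Fin k → Set
  Continues x u r = IsEdge u × Heavy x u × EdgeOn par x (Ps r)

  continues? : ∀ x u r → Dec (Continues x u r)
  continues? x u r = isEdge? u ×-dec heavy? x u ×-dec edgeOn? x (Ps r)

  chainStep : Fin n → Fin n → Fin k × ℕ → Fin k × ℕ
  chainStep x u (r , h) = if does (continues? x u r) then (r , suc h) else (best x , 0)

  chainRoot : Fin n → Fin k × ℕ
  chainRoot x = best x , 0

  -- position x = (owner of the chain of x , number of edges from x up to the top of that chain)
  opaque
    position : Fin n → Fin k × ℕ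
    position = foldUp chainRoot chainStep

    position-parent : ∀ {x u} → par x ≡ just u → position x ≡ chainStep x u (position u)
    position-parent = foldUp-parent chainRoot chainStep

    position-root : ∀ {x} → par x ≡ nothing → position x ≡ chainRoot x
    position-root = foldUp-root chainRoot chainStep

  owner : Fin n → Fin k
  owner = proj₁ ∘ position

  depth : Fin n → ℕ
  depth = proj₂ ∘ position

  ContinuesInto : Fin n → Fin n → Set
  ContinuesInto x u = par x ≡ just u × Continues x u (owner u)

  continuesInto? : ∀ x u → Dec (ContinuesInto x u)
  continuesInto? x u = (par x ≟ᴹ just u) ×-dec continues? x u (owner u)

  ContinuesUp : Fin n → Set
  ContinuesUp x = ∃ (ContinuesInto x)

  continuesUp? : ∀ x → Dec (ContinuesUp x)
  continuesUp? x = parent? (λ u → continues? x u (owner u)) x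

  ChainTop : Fin n → Set
  ChainTop x = ¬ ContinuesUp x

  position-continues : ∀ {x} (c : ContinuesUp x) → position x ≡ (owner (proj₁ c) , suc (depth (proj₁ c)))
  position-continues {x} (u , pu , c) = trans (position-parent pu) (step (continues? x u (owner u)))
    where
    step : (d : Dec (Continues x u (owner u))) →
           (if does d then (owner u , suc (depth u)) else (best x , 0)) ≡ (owner u , suc (depth u))
    step (yes _) = refl
    step (no ¬c) = ⊥-elim (¬c c)

  position-top : ∀ {x} → ChainTop x → position x ≡ (best x , 0)
  position-top {x} top = from-parent (par x) refl
    where
    from-parent : ∀ m → par x ≡ m → position x ≡ (best x , 0)
    from-parent nothing  pu = position-root pu
    from-parent (just u) pu = trans (position-parent pu) (step (continues? x u (owner u)))
      where
      step : (d : Dec (Continues x u (owner u))) →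
             (if does d then (owner u , suc (depth u)) else (best x , 0)) ≡ (best x , 0)
      step (yes c) = ⊥-elim (top (u , pu , c))
      step (no _)  = refl

  owner-continues : ∀ {x} (c : ContinuesUp x) → owner x ≡ owner (proj₁ c)
  owner-continues c = cong proj₁ (position-continues c)

  depth-continues : ∀ {x} (c : ContinuesUp x) → depth x ≡ suc (depth (proj₁ c))
  depth-continues c = cong proj₂ (position-continues c)

  owner-top : ∀ {x} → ChainTop x → owner x ≡ best x
  owner-top top = cong proj₁ (position-top top)

  depth-top : ∀ {x} → ChainTop x → depth x ≡ 0
  depth-top top = cong proj₂ (position-top top)

  continuesUp-depth : ∀ {x} → depth x ≢ 0 → ContinuesUp x
  continuesUp-depth {x} depth≢0 = decidable-stable (continuesUp? x) (λ top → depth≢0 (depth-top top))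

  owner-contains : ∀ {x} → IsEdge x → EdgeOn par x (Ps (owner x))
  owner-contains {x} (w , pw) = from (continuesUp? x)
    where
    from : Dec (ContinuesUp x) → EdgeOn par x (Ps (owner x))
    from (yes c@(_ , _ , _ , _ , on)) = subst (λ r → EdgeOn par x (Ps r)) (sym (owner-continues c)) on
    from (no top) = let (_ , on) = covers x (λ pn → case trans (sym pw) pn of λ ()) in
                    subst (λ r → EdgeOn par x (Ps r)) (sym (owner-top top)) (proj₁ (best-maximal on))

  ChainAbove : Fin n → ℕ → Fin n → Set
  ChainAbove y s z = anc par s y ≡ just z × owner z ≡ owner y × depth z + s ≡ depth y × IsEdge z

  climb : ∀ {y} → IsEdge y → ∀ s → s ≤ depth y → ∃ (ChainAbove y s)
  climb {y} ey zero    _ = y , refl , refl , +-identityʳ (depth y) , ey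
  climb {y} ey (suc s) s<depth with climb ey s (<⇒≤ s<depth)
  ... | z , ez , oz , dz , _ = up (continuesUp-depth depth≢0)
    where
    depth≢0 : depth z ≢ 0
    depth≢0 d≡0 = <⇒≢ s<depth (trans (sym (cong (_+ s) d≡0)) dz)
    up : ContinuesUp z → ∃ (ChainAbove y (suc s))
    up c@(u , pz , eu , _) = u , trans (anc-suc-just s ez) pz , trans (sym (owner-continues c)) oz ,
                             trans (+-suc (depth u) s) (trans (cong (_+ s) (sym (depth-continues c))) dz) , eu

  climb-to : ∀ {y s z} → IsEdge y → s ≤ depth y → anc par s y ≡ just z → ChainAbove y s z
  climb-to ey s≤d ez with climb ey _ s≤d
  ... | z' , ez' , rest with trans (sym ez) ez'
  ...   | refl = ez' , rest

  climb-continues : ∀ {y s z} → IsEdge y → s < depth y → anc par s y ≡ just z → ContinuesUp z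
  climb-continues {y} {s} ey s<d ez with climb-to ey (<⇒≤ s<d) ez
  ... | _ , _ , dz , _ = continuesUp-depth λ d≡0 → <⇒≢ s<d (trans (sym (cong (_+ s) d≡0)) dz)

  climb-top : ∀ {y t} → IsEdge y → anc par (depth y) y ≡ just t → ChainTop t
  climb-top {y} ey et c with climb-to ey ≤-refl et
  ... | _ , _ , dt , _ = 1+n≢0 (trans (sym (depth-continues c)) (+-cancelʳ-≡ (depth y) _ 0 dt))

  chain : Fin n → DPath n
  chain y = dpath y (suc (depth y))

  IsChainBottom : Fin n → Set
  IsChainBottom y = IsEdge y × (∀ c → ¬ ContinuesInto c y)

  isChainBottom? : ∀ y → Dec (IsChainBottom y)
  isChainBottom? y = isEdge? y ×-dec Fin.all? (λ c → ¬? (continuesInto? c y))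

  chain-valid : ∀ {y} → IsEdge y → ValidPath par (chain y)
  chain-valid {y} ey with climb ey (depth y) ≤-refl
  ... | t , et , _ , _ , (_ , pt) = λ none → case trans (sym (trans (anc-suc-just (depth y) et) pt)) none of λ ()

  chain-subpath : ∀ {y} → IsEdge y → SubPath par (chain y) (Ps (owner y))
  chain-subpath {y} ey with owner-contains ey | climb ey (depth y) ≤-refl
  ... | a , _ , ea | t , et , ot , _ , edge-t
    with subst (λ r → EdgeOn par t (Ps r)) ot (owner-contains edge-t)
  ...   | a' , a'<len , ea' = a , ea , subst (_≤ len (Ps (owner y))) top-position a'<len
    where
    top-position : suc a' ≡ a + suc (depth y)
    top-position = trans (cong suc (trans (anc-injective ea' (trans (anc-+-just (depth y) ea) et)) (+-comm (depth y) a)))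
                         (sym (+-suc a (depth y)))

  continuing-child : ∀ {z} → IsEdge z → ¬ IsChainBottom z → ∃ λ c → ContinuesInto c z
  continuing-child {z} ez ¬bot =
    let (c , ¬¬cont) = Fin.¬∀⟶∃¬ n _ (λ c → ¬? (continuesInto? c z)) (λ none → ¬bot (ez , none)) in
    c , decidable-stable (continuesInto? c z) ¬¬cont

  continuing-child-position : ∀ {r p c z} → anc par p (bottom (Ps r)) ≡ just z → owner z ≡ r → ContinuesInto c z →
                              ∃ λ p' → suc p' ≡ p × anc par p' (bottom (Ps r)) ≡ just c
  continuing-child-position {r} {c = c} ez refl (pc , _ , _ , p' , _ , ep') =
    p' , anc-injective (trans (anc-suc-just p' ep') pc) ez , ep'

  chain-cover : ∀ {v} → IsEdge v → ∃ λ y → IsChainBottom y × EdgeOn par v (chain y)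
  chain-cover {v} ev = let (a , _ , ea) = owner-contains ev in descend a ea refl ev (isChainBottom? v)
    where
    descend : ∀ {r} p {z} → anc par p (bottom (Ps r)) ≡ just z → owner z ≡ r → IsEdge z → Dec (IsChainBottom z) →
              ∃ λ y → IsChainBottom y × EdgeOn par z (chain y)
    descend p {z} ez oz edge-z (yes bot) = z , bot , 0 , s≤s z≤n , refl
    descend {r} p {z} ez oz edge-z (no ¬bot) with continuing-child edge-z ¬bot
    ... | c , cont@(pc , _) with continuing-child-position {r} {p} ez oz cont
    ...   | p' , refl , ec with descend p' ec (trans (owner-continues (z , cont)) oz) (z , pc) (isChainBottom? c)
    ...     | y , bot , s , s<d , es with climb-to (proj₁ bot) (s≤s⁻¹ s<d) es
    ...       | _ , _ , dc , _ = y , bot , suc s , s≤s s<depth , trans (anc-suc-just s es) pc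
      where
      s<depth : suc s ≤ depth y
      s<depth = ≤-trans (s≤s (m≤n+m s (depth z))) (≤-reflexive (trans (cong (_+ s) (sym (depth-continues (z , cont)))) dc))

  bottom-not-inside : ∀ {y y' d} → IsChainBottom y' → IsEdge y → suc d ≤ depth y → anc par (suc d) y ≡ just y' → ⊥
  bottom-not-inside {y} {y'} {d} (_ , nothing-continues) ey d<depth ed with climb ey d (<⇒≤ d<depth)
  ... | c , ec , _ with climb-continues ey d<depth ec
  ...   | u , pu , cont with just-injective (trans (sym (trans (anc-suc-just d ec) pu)) ed)
  ...     | refl = nothing-continues c (pu , cont)

  bottoms-on-path : ∀ {b y y' a a' s s'} → anc par a b ≡ just y → anc par a' b ≡ just y' → a ≤ a' →
                    s + a ≡ s' + a' → s ≤ depth y → IsEdge y → IsChainBottom y' → y ≡ y'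
  bottoms-on-path {y = y} {a = a} {a'} {s} {s'} ea ea' a≤a' same-x s≤d ey bot'
    with a' ∸ a | anc-∸-just a≤a' ea | gap≤s
    where
    gap≤s : a' ∸ a ≤ s
    gap≤s = ≤-trans (∸-monoˡ-≤ a (≤-trans (m≤n+m a' s') (≤-reflexive (sym same-x)))) (≤-reflexive (m+n∸n≡m s a))
  ... | zero  | ea'' | _     = just-injective (trans (sym ea'') ea')
  ... | suc d | ea'' | d<s   = ⊥-elim (bottom-not-inside bot' ey (≤-trans d<s s≤d) (trans (sym ea'') ea'))

  chains-disjoint : ∀ {y y' s s' x} → IsChainBottom y → IsChainBottom y' →
                    s ≤ depth y → anc par s y ≡ just x → s' ≤ depth y' → anc par s' y' ≡ just x → y ≡ y'
  chains-disjoint {y} {y'} {s} {s'} bot bot' s≤d ex s'≤d' ex'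
    with climb-to (proj₁ bot) s≤d ex | climb-to (proj₁ bot') s'≤d' ex'
  ... | _ , ox , _ | _ , ox' , _ with owner-contains (proj₁ bot) | owner-contains (proj₁ bot')
  ...   | a , _ , ea | a' , _ , ea₀' = compare (≤-total a a')
    where
    ea' : anc par a' (bottom (Ps (owner y))) ≡ just y'
    ea' = subst (λ r → anc par a' (bottom (Ps r)) ≡ just y') (trans (sym ox') ox) ea₀'
    same-x : s + a ≡ s' + a'
    same-x = anc-injective (trans (anc-+-just s ea) ex) (trans (anc-+-just s' ea') ex')
    compare : a ≤ a' ⊎ a' ≤ a → y ≡ y'
    compare (inj₁ a≤a') = bottoms-on-path ea ea' a≤a' same-x s≤d (proj₁ bot) bot'
    compare (inj₂ a'≤a) = sym (bottoms-on-path ea' ea a'≤a (sym same-x) s'≤d' (proj₁ bot') bot)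

  ContainsChainTop : Fin k → Fin n → Set
  ContainsChainTop i y = Any (λ t → EdgeOn par t (Ps i)) (anc par (depth y) y)

  containsChainTop? : ∀ i y → Dec (ContainsChainTop i y)
  containsChainTop? i y = Anyᴹ.dec (λ t → edgeOn? t (Ps i)) (anc par (depth y) y)

  -- For an empty path this is its bottom vertex, a junk value.
  topEdge : DPath n → Maybe (Fin n)
  topEdge P = anc par (pred (len P)) (bottom P)

  EndsOnChain : Fin k → Fin n → Set
  EndsOnChain i y = ∃ λ s → s < suc (depth y) × anc par s y ≡ topEdge (Ps i)

  endsOnChain? : ∀ i y → Dec (EndsOnChain i y)
  endsOnChain? i y = anyUpTo? (λ s → anc par s y ≟ᴹ topEdge (Ps i)) (suc (depth y))

  -- Upwards from a common vertex, both paths agree until one of them ends.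
  share-chain : ∀ {i y} → IsEdge y → ShareEdge par (Ps i) (chain y) → ContainsChainTop i y ⊎ EndsOnChain i y
  share-chain {i} {y} ey (j , j' , same) with climb ey (toℕ j') (s≤s⁻¹ (toℕ<n j'))
  ... | x , ex , _ = compare (≤-total (pred L ∸ toℕ j) (depth y ∸ toℕ j'))
    where
    L : ℕ
    L = len (Ps i)
    b : Fin n
    b = bottom (Ps i)
    j≤top : toℕ j ≤ pred L
    j≤top = <⇒≤pred (toℕ<n j)
    j'≤depth : toℕ j' ≤ depth y
    j'≤depth = s≤s⁻¹ (toℕ<n j')
    ex' : anc par (toℕ j) b ≡ just x
    ex' = trans same ex
    compare : pred L ∸ toℕ j ≤ depth y ∸ toℕ j' ⊎ depth y ∸ toℕ j' ≤ pred L ∸ toℕ j →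
              ContainsChainTop i y ⊎ EndsOnChain i y
    compare (inj₁ g≤h) = inj₂ (g + toℕ j' , s≤s (≤-trans (+-monoˡ-≤ (toℕ j') g≤h) (≤-reflexive (m∸n+n≡m j'≤depth))) ,
                               (begin
      anc par (g + toℕ j') y ≡⟨ anc-+-just g ex ⟩
      anc par g x            ≡⟨ anc-+-just g ex' ⟨
      anc par (g + toℕ j) b  ≡⟨ cong (λ m → anc par m b) (m∸n+n≡m j≤top) ⟩
      topEdge (Ps i)         ∎))
      where
      open ≡-Reasoning
      g : ℕ
      g = pred L ∸ toℕ j
    compare (inj₂ h≤g) with climb ey (depth y) ≤-refl
    ... | t , et , _ = inj₁ (subst (Any (λ t → EdgeOn par t (Ps i))) (sym et) (just (h + toℕ j , h+j<L , (begin
      anc par (h + toℕ j) b  ≡⟨ anc-+-just h ex' ⟩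
      anc par h x            ≡⟨ anc-+-just h ex ⟨
      anc par (h + toℕ j') y ≡⟨ cong (λ m → anc par m y) (m∸n+n≡m j'≤depth) ⟩
      anc par (depth y) y    ≡⟨ et ⟩
      just t                 ∎))))
      where
      open ≡-Reasoning
      h : ℕ
      h = depth y ∸ toℕ j'
      h+j<L : h + toℕ j < L
      h+j<L = m≤pred[n]⇒suc[m]≤n ⦃ >-nonZero (≤-trans z<s (toℕ<n j)) ⦄
                (≤-trans (+-monoˡ-≤ (toℕ j) h≤g) (≤-reflexive (m∸n+n≡m j≤top)))

  heavy-run-to-chain-top : ∀ {x u t} → par x ≡ just u → IsEdge u → Heavy x u → anc par (depth u) u ≡ just t → HeavyRun x t
  heavy-run-to-chain-top {x} {u} pu edge-u heavy et =
    depth u , anc-<n (depth u) et , trans (anc-suc-parent (depth u) pu) et , heavy-steps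
    where
    heavy-steps : ∀ {s} → s < suc (depth u) → Any HeavyUp (anc par s x)
    heavy-steps {zero}   _ = just (u , pu , heavy)
    heavy-steps {suc s} s<d with climb edge-u s (s≤s⁻¹ (<⇒≤ s<d))
    ... | z , ez , _ with climb-continues edge-u (s≤s⁻¹ s<d) ez
    ...   | u' , pz , _ , heavy' , _ = subst (Any HeavyUp) (sym (trans (anc-suc-parent s pu) ez)) (just (u' , pz , heavy'))

  heavy-child-on-path : ∀ {r w t u x d h aw au} → anc par aw (bottom (Ps r)) ≡ just w → anc par au (bottom (Ps r)) ≡ just u →
                        aw < au → anc par (suc d) w ≡ just t → (∀ {s} → s < suc d → Any HeavyUp (anc par s w)) →
                        anc par h u ≡ just t → par x ≡ just u → Heavy x u → au < len (Ps r) →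
                        EdgeOn par x (Ps r)
  heavy-child-on-path {r} {w} {t} {u} {x} {d} {h} {aw} {au} ew eu aw<au ewt heavy-run et pu heavy au<len
    with au ∸ aw in gap | anc-∸-just (<⇒≤ aw<au) ew | m<n⇒0<n∸m aw<au
  ... | zero   | _  | ()
  ... | suc d' | wu | _ with anc-defined {d'} {suc d'} {w} (n≤1+n d') (λ none → case trans (sym (trans (sym wu) eu)) none of λ ())
  ...   | c , ec = subst (λ c → EdgeOn par c (Ps r)) c≡x (d' + aw , c-position , trans (anc-+-just d' ew) ec)
    where
    pc : par c ≡ just u
    pc = trans (sym (anc-suc-just d' ec)) (trans (sym wu) eu)
    d'<suc-d : d' < suc d
    d'<suc-d = ≤-trans (m≤n+m (suc d') h) (≤-reflexive (anc-injective {h + suc d'} {suc d}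
                 (trans (anc-+-just h (trans (sym wu) eu)) et) ewt))
    c≡x : c ≡ x
    c≡x with subst (Any HeavyUp) ec (heavy-run d'<suc-d)
    ... | just (u' , pc' , heavy') with trans (sym pc') pc
    ...   | refl = heavy-unique pc' pu heavy' heavy
    c-position : d' + aw < len (Ps r)
    c-position = ≤-trans (≤-reflexive (trans (cong (_+ aw) (sym gap)) (m∸n+n≡m (<⇒≤ aw<au)))) (<⇒≤ au<len)

  -- P_i would follow the heavy run below t further than its owner best t does.
  heavy-edge-off-owner-impossible : ∀ {i j x u t} → anc par j (bottom (Ps i)) ≡ just x → par x ≡ just u → IsEdge u → Heavy x u →
                         ¬ EdgeOn par x (Ps (owner u)) → anc par (depth u) u ≡ just t → depth u + suc j < len (Ps i) → ⊥
  heavy-edge-off-owner-impossible {i} {j} {x} {u} {t} ex pu edge-u heavy x-off et top-inside =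
    <⇒≱ (reach-< inclusion x-off (j , x-inside , ex) (heavy-run-to-chain-top pu edge-u heavy et))
        (subst (λ r → reach i t ≤ reach r t) (sym owner≡best) (proj₂ (best-maximal t-on-i)))
    where
    eu : anc par (suc j) (bottom (Ps i)) ≡ just u
    eu = trans (anc-suc-just j ex) pu
    x-inside : j < len (Ps i)
    x-inside = ≤-trans (s≤s (m≤n+m j (depth u))) (≤-trans (≤-reflexive (sym (+-suc (depth u) j))) (<⇒≤ top-inside))
    t-on-i : EdgeOn par t (Ps i)
    t-on-i = depth u + suc j , top-inside , trans (anc-+-just (depth u) eu) et
    owner≡best : owner u ≡ best t
    owner≡best = trans (sym (proj₁ (proj₂ (climb-to edge-u ≤-refl et)))) (owner-top (climb-top edge-u et))
    inclusion : ∀ {w} → EdgeOn par w (Ps (owner u)) → HeavyRun w t → EdgeOn par w (Ps i)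
    inclusion {w} (aw , _ , ew) (d , _ , ewt , heavy-run) = compare (aw <? au)
      where
      au : ℕ
      au = proj₁ (owner-contains edge-u)
      au<len : au < len (Ps (owner u))
      au<len = proj₁ (proj₂ (owner-contains edge-u))
      eu' : anc par au (bottom (Ps (owner u))) ≡ just u
      eu' = proj₂ (proj₂ (owner-contains edge-u))
      compare : Dec (aw < au) → EdgeOn par w (Ps i)
      compare (yes aw<au) = ⊥-elim (x-off (heavy-child-on-path {h = depth u} ew eu' aw<au ewt heavy-run et pu heavy au<len))
      compare (no aw≮au) = e + suc j , w-inside , trans (anc-+-just e eu) uw
        where
        e : ℕ
        e = aw ∸ au
        uw : anc par e u ≡ just w
        uw = trans (sym (anc-∸-just (≮⇒≥ aw≮au) eu')) ew
        d+e≡depth : suc d + e ≡ depth u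
        d+e≡depth = anc-injective {suc d + e} {depth u} (trans (anc-+-just (suc d) uw) ewt) et
        w-inside : e + suc j < len (Ps i)
        w-inside = <-trans (+-monoˡ-< (suc j) (≤-trans (s≤s (m≤n+m e d)) (≤-reflexive d+e≡depth))) top-inside

  ChainTopEdge : Fin n → Set
  ChainTopEdge x = IsEdge x × ChainTop x

  chainTopEdge? : ∀ x → Dec (ChainTopEdge x)
  chainTopEdge? x = isEdge? x ×-dec ¬? (continuesUp? x)

  Light : Fin n → Set
  Light x = Any (λ u → weight x + weight x ≤ weight u) (par x)

  light? : ∀ x → Dec (Light x)
  light? x = Anyᴹ.dec (λ u → weight x + weight x ≤? weight u) (par x)

  module AlongPath (i : Fin k) (valid-i : ValidPath par (Ps i)) where

    private
      b : Fin n
      b = bottom (Ps i)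
      L : ℕ
      L = len (Ps i)

    TopAt : ℕ → Set
    TopAt j = Any ChainTopEdge (anc par j b)

    topAt? : ∀ j → Dec (TopAt j)
    topAt? j = Anyᴹ.dec chainTopEdge? (anc par j b)

    LightAt : ℕ → Set
    LightAt j = Any Light (anc par j b)

    lightAt? : ∀ j → Dec (LightAt j)
    lightAt? j = Anyᴹ.dec light? (anc par j b)

    lights : ℕ
    lights = count< L lightAt?

    vertex-at : ∀ {j} → j ≤ L → ∃ λ x → anc par j b ≡ just x
    vertex-at j≤L = anc-defined j≤L valid-i

    light-between-tops : ∀ {j j'} → j < j' → j' < L → TopAt j → TopAt j' → LightAt j
    light-between-tops {j} {j'} j<j' j'<L top-j top-j'
      with vertex-at (<⇒≤ (<-trans j<j' j'<L)) | vertex-at (<-trans j<j' j'<L)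
         | vertex-at (≤-trans (s≤s j<j') j'<L) | vertex-at (<⇒≤ j'<L)
    ... | x , ex | u , eu | v , ev | w' , ew' = decide (weight x + weight x ≤? weight u)
      where
      pu : par x ≡ just u
      pu = trans (sym (anc-suc-just j ex)) eu
      edge-u : IsEdge u
      edge-u = v , trans (sym (anc-suc-just (suc j) eu)) ev
      top-x : ChainTop x
      top-x = proj₂ (Anyᴹ.drop-just (subst (Any ChainTopEdge) ex top-j))
      top-w' : ChainTop w'
      top-w' = proj₂ (Anyᴹ.drop-just (subst (Any ChainTopEdge) ew' top-j'))
      uw' : anc par (j' ∸ suc j) u ≡ just w'
      uw' = trans (sym (anc-∸-just j<j' eu)) ew'
      depth≤ : depth u ≤ j' ∸ suc j
      depth≤ = ≮⇒≥ λ gap<depth → top-w' (climb-continues edge-u gap<depth uw')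
      chain-top-inside : depth u + suc j < L
      chain-top-inside = ≤-trans (s≤s (≤-trans (+-monoˡ-≤ (suc j) depth≤) (≤-reflexive (m∸n+n≡m j<j')))) j'<L
      decide : Dec (weight x + weight x ≤ weight u) → LightAt j
      decide (yes light) = subst (Any Light) (sym ex) (just (subst (Any _) (sym pu) (just light)))
      decide (no ¬light) = ⊥-elim (heavy-edge-off-owner-impossible ex pu edge-u heavy x-off et chain-top-inside)
        where
        heavy : Heavy x u
        heavy = ≰⇒> ¬light
        x-off : ¬ EdgeOn par x (Ps (owner u))
        x-off on = top-x (u , pu , edge-u , heavy , on)
        et : anc par (depth u) u ≡ just (proj₁ (climb edge-u (depth u) ≤-refl))
        et = proj₁ (proj₂ (climb edge-u (depth u) ≤-refl))

    chain-tops-on-path : count (λ x → chainTopEdge? x ×-dec edgeOn? x (Ps i)) ≤ 1 + lights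
    chain-tops-on-path = ≤-trans
      (count-≤-via _ (topAt? ∘ toℕ) (λ j x → (anc par (toℕ j) b ≟ᴹ just x) ×-dec chainTopEdge? x)
        (λ x (top , on) → let (j , ex) = edgeOn-position on in j , ex , top)
        (λ j x y (ex , _) (ey , _) → just-injective (trans (sym ex) ey))
        (λ j x (ex , top) → subst (Any ChainTopEdge) (sym ex) (just top)))
      (count<-≤-1+ topAt? lightAt? L light-between-tops)

    weight-doubling : ∀ m {x} → m ≤ L → anc par m b ≡ just x → 2 ^ count< m lightAt? * weight b ≤ weight x
    weight-doubling zero    _   refl = ≤-reflexive (+-identityʳ (weight b))
    weight-doubling (suc m) {x} m<L ex with vertex-at (<⇒≤ m<L)
    ... | y , ey = subst (_≤ weight x) (cong (λ c → 2 ^ c * weight b) (sym (sum<-suc m (𝟙 ∘ lightAt?))))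
                         (step (lightAt? m))
      where
      open ≤-Reasoning
      c : ℕ
      c = count< m lightAt?
      py : par y ≡ just x
      py = trans (sym (anc-suc-just m ey)) ex
      below-y : 2 ^ c * weight b ≤ weight y
      below-y = weight-doubling m (<⇒≤ m<L) ey
      step : (d : Dec (LightAt m)) → 2 ^ (c + 𝟙 d) * weight b ≤ weight x
      step (yes light) = begin
        2 ^ (c + 1) * weight b ≡⟨ cong (λ e → 2 ^ e * weight b) (+-comm c 1) ⟩
        2 * 2 ^ c * weight b   ≡⟨ *-assoc 2 (2 ^ c) (weight b) ⟩
        2 * (2 ^ c * weight b) ≤⟨ *-monoʳ-≤ 2 below-y ⟩
        2 * weight y           ≡⟨ cong (weight y +_) (+-identityʳ (weight y)) ⟩
        weight y + weight y    ≤⟨ Anyᴹ.drop-just (subst (Any _) py (Anyᴹ.drop-just (subst (Any Light) ey light))) ⟩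
        weight x               ∎
      step (no _) = begin
        2 ^ (c + 0) * weight b ≡⟨ cong (λ e → 2 ^ e * weight b) (+-identityʳ c) ⟩
        2 ^ c * weight b       ≤⟨ below-y ⟩
        weight y               ≤⟨ weight-parent py ⟩
        weight x               ∎

    lights-bound : 2 ^ lights ≤ k
    lights-bound = begin
      2 ^ lights              ≡⟨ *-identityʳ _ ⟨
      2 ^ lights * 1          ≤⟨ *-monoʳ-≤ (2 ^ lights) (weight-bottom i) ⟩
      2 ^ lights * weight b   ≤⟨ weight-doubling L ≤-refl (proj₂ highest) ⟩
      weight (proj₁ highest)  ≤⟨ weight-≤ (proj₁ highest) ⟩
      k                       ∎
      where
      open ≤-Reasoning
      highest : ∃ λ x → anc par L b ≡ just x
      highest = vertex-at ≤-refl

  module Counting (valid : ∀ i → ValidPath par (Ps i)) where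

    lights : Fin k → ℕ
    lights i = AlongPath.lights i (valid i)

    isBottom : Fin n → ℕ
    isBottom y = 𝟙 (isChainBottom? y)

    edges-≤-chain-lengths : numEdges par ≤ ∑[ y < n ] (isBottom y * len (chain y))
    edges-≤-chain-lengths = begin
      numEdges par                        ≡⟨ length-filter-tabulate (λ v → T? (is-just (par v))) id ⟩
      count (λ v → T? (is-just (par v)))  ≤⟨ count-≤-∑count _ (λ y v → isChainBottom? y ×-dec edgeOn? v (chain y)) covered ⟩
      ∑[ y < n ] count (λ v → isChainBottom? y ×-dec edgeOn? v (chain y))
                                          ≡⟨ sum-cong-≗ {n} (λ y → sum-cong-≗ {n} (λ v → 𝟙-×-dec (isChainBottom? y) _)) ⟩
      ∑[ y < n ] ∑[ v < n ] (isBottom y * 𝟙 (edgeOn? v (chain y)))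
                                          ≡⟨ sum-cong-≗ {n} (λ y → sym (*-distribˡ-sum (isBottom y) (𝟙 ∘ λ v → edgeOn? v (chain y)))) ⟩
      ∑[ y < n ] (isBottom y * count (λ v → edgeOn? v (chain y)))
                                          ≤⟨ sum-mono-≤ (λ y → *-monoʳ-≤ (isBottom y) (edges-on-path (chain y))) ⟩
      ∑[ y < n ] (isBottom y * len (chain y)) ∎
      where
      open ≤-Reasoning
      covered : ∀ v → T (is-just (par v)) → ∃ λ y → IsChainBottom y × EdgeOn par v (chain y)
      covered v t with par v in pv
      ... | just w = chain-cover (w , pv)

    sharing-≤ : ∀ {y} → IsChainBottom y →
                numSharing par Ps (chain y) ≤ ∑[ i < k ] (𝟙 (containsChainTop? i y) + 𝟙 (endsOnChain? i y))
    sharing-≤ {y} bot = ≤-trans (≤-reflexive (length-filter-tabulate (λ i → shareEdge? par (Ps i) (chain y)) id))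
      (sum-mono-≤ λ i → 𝟙-⊎ (shareEdge? par (Ps i) (chain y)) (containsChainTop? i y) (endsOnChain? i y) (share-chain (proj₁ bot)))

    chain-tops-shared-≤ : ∀ i → ∑[ y < n ] (isBottom y * 𝟙 (containsChainTop? i y)) ≤ 1 + lights i
    chain-tops-shared-≤ i = begin
      ∑[ y < n ] (isBottom y * 𝟙 (containsChainTop? i y))        ≡⟨ sum-cong-≗ {n} (λ y → 𝟙-×-dec (isChainBottom? y) _) ⟨
      count (λ y → isChainBottom? y ×-dec containsChainTop? i y) ≤⟨ count-≤-via _ _ topOf? hit unique into ⟩
      count (λ x → chainTopEdge? x ×-dec edgeOn? x (Ps i))      ≤⟨ AlongPath.chain-tops-on-path i (valid i) ⟩
      1 + lights i                                               ∎
      where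
      open ≤-Reasoning
      TopOf : Fin n → Fin n → Set
      TopOf x y = IsChainBottom y × anc par (depth y) y ≡ just x × EdgeOn par x (Ps i)
      topOf? : ∀ x y → Dec (TopOf x y)
      topOf? x y = isChainBottom? y ×-dec (anc par (depth y) y ≟ᴹ just x) ×-dec edgeOn? x (Ps i)
      hit : ∀ y → IsChainBottom y × ContainsChainTop i y → ∃ λ x → TopOf x y
      hit y (bot , contains) with climb (proj₁ bot) (depth y) ≤-refl
      ... | t , et , _ = t , bot , et , Anyᴹ.drop-just (subst (Any _) et contains)
      unique : ∀ x y y' → TopOf x y → TopOf x y' → y ≡ y'
      unique x y y' (bot , ex , _) (bot' , ex' , _) = chains-disjoint bot bot' ≤-refl ex ≤-refl ex'
      into : ∀ x y → TopOf x y → ChainTopEdge x × EdgeOn par x (Ps i)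
      into x y (bot , ex , on) = (proj₂ (proj₂ (proj₂ (climb-to (proj₁ bot) ≤-refl ex))) , climb-top (proj₁ bot) ex) , on

    path-ends-shared-≤ : ∀ i → ∑[ y < n ] (isBottom y * 𝟙 (endsOnChain? i y)) ≤ 1
    path-ends-shared-≤ i with anc-defined {pred (len (Ps i))} {len (Ps i)} pred[n]≤n (valid i)
    ... | x , ex = begin
      ∑[ y < n ] (isBottom y * 𝟙 (endsOnChain? i y))        ≡⟨ sum-cong-≗ {n} (λ y → 𝟙-×-dec (isChainBottom? y) _) ⟨
      count (λ y → isChainBottom? y ×-dec endsOnChain? i y) ≤⟨ count-≤1 _ unique ⟩
      1                                                     ∎
      where
      open ≤-Reasoning
      unique : ∀ y y' → IsChainBottom y × EndsOnChain i y → IsChainBottom y' × EndsOnChain i y' → y ≡ y'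
      unique y y' (bot , s , s≤d , es) (bot' , s' , s'≤d' , es') =
        chains-disjoint bot bot' (s≤s⁻¹ s≤d) (trans es ex) (s≤s⁻¹ s'≤d') (trans es' ex)

    bottoms-sharing-≤ : ∑[ y < n ] (isBottom y * numSharing par Ps (chain y)) ≤ ∑[ i < k ] (2 + lights i)
    bottoms-sharing-≤ = begin
      ∑[ y < n ] (isBottom y * numSharing par Ps (chain y))
        ≤⟨ sum-mono-≤ (λ y → per-bottom (isChainBottom? y)) ⟩
      ∑[ y < n ] (isBottom y * ∑[ i < k ] (top i y + end i y))
        ≡⟨ sum-cong-≗ {n} distribute ⟩
      ∑[ y < n ] ∑[ i < k ] (isBottom y * top i y + isBottom y * end i y)
        ≡⟨ ∑-comm (λ y i → isBottom y * top i y + isBottom y * end i y) ⟩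
      ∑[ i < k ] ∑[ y < n ] (isBottom y * top i y + isBottom y * end i y)
        ≡⟨ sum-cong-≗ {k} (λ i → ∑-distrib-+ (λ y → isBottom y * top i y) (λ y → isBottom y * end i y)) ⟩
      ∑[ i < k ] (∑[ y < n ] (isBottom y * top i y) + ∑[ y < n ] (isBottom y * end i y))
        ≤⟨ sum-mono-≤ (λ i → +-mono-≤ (chain-tops-shared-≤ i) (path-ends-shared-≤ i)) ⟩
      ∑[ i < k ] (1 + lights i + 1)
        ≡⟨ sum-cong-≗ {k} (λ i → +-comm (1 + lights i) 1) ⟩
      ∑[ i < k ] (2 + lights i)
        ∎
      where
      open ≤-Reasoning
      top end : Fin k → Fin n → ℕ
      top i y = 𝟙 (containsChainTop? i y)
      end i y = 𝟙 (endsOnChain? i y)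
      per-bottom : ∀ {y} (d : Dec (IsChainBottom y)) →
                   𝟙 d * numSharing par Ps (chain y) ≤ 𝟙 d * ∑[ i < k ] (top i y + end i y)
      per-bottom (yes bot) = *-monoʳ-≤ 1 (sharing-≤ bot)
      per-bottom (no _)    = z≤n
      distribute : ∀ y → isBottom y * ∑[ i < k ] (top i y + end i y) ≡ ∑[ i < k ] (isBottom y * top i y + isBottom y * end i y)
      distribute y = trans (*-distribˡ-sum (isBottom y) (λ i → top i y + end i y))
                           (sum-cong-≗ {k} (λ i → *-distribˡ-+ (isBottom y) (top i y) (end i y)))

    edges-≤-sharing : ∀ p q → (∀ y → IsChainBottom y → len (chain y) * q ≤ numSharing par Ps (chain y) * p) →
                      numEdges par * q ≤ ∑[ i < k ] (2 + lights i) * p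
    edges-≤-sharing p q dense = begin
      numEdges par * q                                          ≤⟨ *-monoˡ-≤ q edges-≤-chain-lengths ⟩
      ∑[ y < n ] (isBottom y * len (chain y)) * q               ≡⟨ *-distribʳ-sum q (λ y → isBottom y * len (chain y)) ⟩
      ∑[ y < n ] (isBottom y * len (chain y) * q)               ≤⟨ sum-mono-≤ (λ y → per-bottom (isChainBottom? y)) ⟩
      ∑[ y < n ] (isBottom y * numSharing par Ps (chain y) * p) ≡⟨ *-distribʳ-sum p (λ y → isBottom y * numSharing par Ps (chain y)) ⟨
      ∑[ y < n ] (isBottom y * numSharing par Ps (chain y)) * p ≤⟨ *-monoˡ-≤ p bottoms-sharing-≤ ⟩
      ∑[ i < k ] (2 + lights i) * p                             ∎
      where
      open ≤-Reasoning
      per-bottom : ∀ {y} (d : Dec (IsChainBottom y)) → 𝟙 d * len (chain y) * q ≤ 𝟙 d * numSharing par Ps (chain y) * p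
      per-bottom {y} (yes bot) = subst₂ _≤_ (cong (_* q) (sym (*-identityˡ (len (chain y)))))
                                            (cong (_* p) (sym (*-identityˡ (numSharing par Ps (chain y))))) (dense y bot)
      per-bottom     (no _)    = z≤n

lemma5 : (p q : ℕ) → 1 ≤ q → q ≤ p →
         (n : ℕ) (par : Parent n) → IsRootedForest par →
         (k : ℕ) → 1 ≤ k → (Ps : Fin k → DPath n) →
         (∀ i → ValidPath par (Ps i)) → Covers par Ps →
         BigEnough p q k (numEdges par) →
         Σ (DPath n) λ Q → Sparse par Ps p q Q
lemma5 p q 1≤q q≤p n par acyclic k 1≤k Ps valid covers (M≤Eq , k^M≤2^[Eq-M]) =
  search (Fin.any? λ y → isChainBottom? y ×-dec (numSharing par Ps (chain y) * p ≤? len (chain y) * q))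
  where
  open Decomposition par acyclic ⦃ >-nonZero 1≤k ⦄ Ps covers
  open Counting valid
  search : Dec (∃ λ y → IsChainBottom y × numSharing par Ps (chain y) * p ≤ len (chain y) * q) →
           Σ (DPath n) λ Q → Sparse par Ps p q Q
  search (yes (y , (edge-y , _) , sparse)) =
    chain y , chain-valid edge-y , (owner y , chain-subpath edge-y) , s≤s z≤n , sparse
  search (no none) =
    ⊥-elim (<⇒≱ (∑[2+ℓ]*p<X lights (≤-trans 1≤q q≤p) 1≤k M≤Eq lights-small) (edges-≤-sharing p q dense))
    where
    dense : ∀ y → IsChainBottom y → len (chain y) * q ≤ numSharing par Ps (chain y) * p
    dense y bot = <⇒≤ (≰⇒> λ sparse → none (y , bot , sparse))
    lights-small : ∀ i → lights i * (4 * p * k) ≤ numEdges par * q ∸ 4 * p * k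
    lights-small i = exponent-≤ {lights i} {k} {4 * p * k} (AlongPath.lights-bound i (valid i)) k^M≤2^[Eq-M]
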